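{- Let $g$ be a positive integer. Then $N_{g,d}=N_{g,g}$ for all integers $d\geq g$.
   Context: A generalized numerical semigroup (GNS) in $\mathbb{N}^d$ is a submonoid $S$ of $(\mathbb{N}^d,+)$ such that the set of gaps $\operatorname{H}(S)=\mathbb{N}^d\setminus S$ is finite; its genus is $\operatorname{g}(S)=|\operatorname{H}(S)|$. $\mathcal{S}_{g,d}$ denotes the set of GNSs in $\mathbb{N}^d$ of genus $g$. Two GNSs $S,T\subseteq\mathbb{N}^d$ are isomorphic if there is a bijective monoid homomorphism $S\to T$. $N_{g,d}$ denotes the number of isomorphism classes of GNSs in $\mathcal{S}_{g,d}$. -}

module Defs where

open import Data.Nat using (ℕ; _+_)
open import Data.Vec using (Vec; zipWith; replicate; lookup)
open import Data.Fin using (Fin)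
open import Data.List using (List; length)
open import Data.List.Membership.Propositional using (_∈_; _∉_)
open import Data.List.Relation.Unary.Unique.Propositional using (Unique)
open import Data.Product using (Σ; ∃; _×_; _,_)
open import Relation.Binary.PropositionalEquality using (_≡_; _≢_)
open import Relation.Nullary using (¬_)

ℕ^ : ℕ → Set
ℕ^ d = Vec ℕ d

_⊕_ : ∀ {d} → ℕ^ d → ℕ^ d → ℕ^ d
_⊕_ = zipWith _+_

𝟎 : ∀ {d} → ℕ^ d
𝟎 {d} = replicate d 0

-- A generalized numerical semigroup S ⊆ ℕ^d of genus g, given by its
-- (finite) gap set H(S) = ℕ^d \ S, listed without repetition.
record GNS (d g : ℕ) : Set where
  field
    gaps       : List (ℕ^ d)
    gapsUnique : Unique gaps
    genus      : length gaps ≡ g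
    zero∈S     : 𝟎 ∉ gaps
    closed     : ∀ x y → x ∉ gaps → y ∉ gaps → (x ⊕ y) ∉ gaps

open GNS public

_∈S_ : ∀ {d g} → ℕ^ d → GNS d g → Set
x ∈S S = x ∉ gaps S

record Iso {d e g h : ℕ} (S : GNS d g) (T : GNS e h) : Set where
  field
    fun        : (x : ℕ^ d) → x ∈S S → ℕ^ e
    fun-irr    : ∀ x (p q : x ∈S S) → fun x p ≡ fun x q
    fun-into   : ∀ x (p : x ∈S S) → fun x p ∈S T
    hom-zero   : (p : 𝟎 ∈S S) → fun 𝟎 p ≡ 𝟎
    hom-plus   : ∀ x y (p : x ∈S S) (q : y ∈S S) (r : (x ⊕ y) ∈S S) →
                 fun (x ⊕ y) r ≡ fun x p ⊕ fun y q
    injective  : ∀ x y (p : x ∈S S) (q : y ∈S S) → fun x p ≡ fun y q → x ≡ y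
    surjective : ∀ z → z ∈S T → Σ (ℕ^ d) λ x → Σ (x ∈S S) λ p → fun x p ≡ z

-- N_{g,d} = n : there are exactly n isomorphism classes of GNSs in ℕ^d of
-- genus g, witnessed by n pairwise non-isomorphic representatives such that
-- every GNS in ℕ^d of genus g is isomorphic to one of them.
IsoClassCount : (g d n : ℕ) → Set
IsoClassCount g d n =
  Σ (Vec (GNS d g) n) λ reps →
    (∀ (i j : Fin n) → i ≢ j → ¬ Iso (lookup reps i) (lookup reps j)) ×
    (∀ (S : GNS d g) → ∃ λ (i : Fin n) → Iso S (lookup reps i))

-- An isomorphism between generalized numerical semigroups of genus g in ℕ^d is a
-- permutation of coordinates. Every point with a coordinate ≥ K = g(g+1)+1 lies in the
-- semigroup, so K·x is the sum of the elements xᵢ·(K eᵢ) and K·φ(x) = Σᵢ xᵢ φ(K eᵢ) is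
-- linear in x; surjectivity onto the axes forces the matrix (φ(K eᵢ))ᵢ to be K times a
-- permutation matrix. As gap coordinates are bounded, there are finitely many such
-- semigroups and isomorphism is decidable, so the classes can be counted. Finally, the
-- lightest gap x with xₚ ≠ 0 determines p, so the gaps of a semigroup of genus g involve
-- at most g coordinates: for d > g every semigroup in ℕ^d is, after permuting
-- coordinates, the one with gaps {0} × H(A) for some A in ℕ^(d-1). As this padding
-- preserves and reflects isomorphism, it matches the classes in ℕ^(d-1) with those in ℕ^d.

module Submission where

open import Defs

open import Data.Empty using (⊥)
open import Data.Fin using (Fin; zero; suc; toℕ; punchOut)
import Data.Fin.Properties as Fin
open import Data.Fin.Permutation
  using ( Permutation′; permutation; _⟨$⟩ʳ_; _⟨$⟩ˡ_; _∘ₚ_; flip; inverseˡ; inverseʳ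
        ; lift₀; remove; lift₀-remove; transpose)
  renaming (id to idₚ; _≈_ to _≈ₚ_)
open import Data.List using (List; length; upTo; allFin; filter) renaming ([] to []ᴸ; _∷_ to _∷ᴸ_)
import Data.List as List
open import Data.List.Extrema.Nat using (argmin; argmin-all; f[argmin]≤f[xs])
open import Data.List.Membership.Propositional using (_∈_; _∉_; lose; find)
open import Data.List.Membership.Propositional.Properties
  using (∈-map⁺; ∈-map⁻; ∈-filter⁺; ∈-filter⁻; ∈-cartesianProductWith⁺; ∈-upTo⁺; ∈-allFin)
import Data.List.Membership.DecPropositional as DecMembership
open import Data.List.Properties using (length-map; map-∘; map-id-local)
open import Data.List.Relation.Unary.All using (All) renaming ([] to []ᴬ; _∷_ to _∷ᴬ_)
import Data.List.Relation.Unary.All as All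
open import Data.List.Relation.Unary.All.Properties using (¬All⇒Any¬)
open import Data.List.Relation.Unary.Any using (Any; index; here; there)
import Data.List.Relation.Unary.Any as Any
open import Data.List.Relation.Unary.Any.Properties using (lookup-index)
open import Data.List.Relation.Unary.Unique.Propositional using (Unique)
import Data.List.Relation.Unary.Unique.Propositional.Properties as Unique
import Data.List.Relation.Unary.Unique.DecPropositional as DecUnique
open import Data.Nat
  using ( ℕ; zero; suc; pred; _+_; _*_; _∸_; _≤_; _<_; _≤′_; ≤′-refl; ≤′-step
        ; _≟_; _≤?_; _<?_; s≤s; s≤s⁻¹; ≢-nonZero)
open import Data.Nat.Divisibility using (_∣_; divides; quotient; ∣m+n∣m⇒∣n; ∣1⇒≡1; m∣m*n)
open import Data.Nat.Properties
open import Algebra.Properties.CommutativeMonoid.Sum +-0-commutativeMonoid using (sum; sum-cong-≗; ∑-distrib-+)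
open import Data.Product using (Σ; ∃; _×_; _,_; proj₁; proj₂)
open import Data.Sum using (_⊎_; fromInj₂; [_,_]′)
import Data.Sum as Sum
open import Data.Vec using (Vec; []; _∷_; lookup; tabulate; map; tail; _[_]≔_)
open import Data.Vec.Properties
  using (lookup-zipWith; lookup-replicate; lookup-map; lookup∘tabulate; tabulate-cong
        ; lookup∘update; lookup∘update′; []≔-lookup; ∷-injectiveʳ; ≡-dec)
open import Data.Vec.Relation.Binary.Pointwise.Extensional using (ext; Pointwise-≡⇒≡)
open import Function using (_∘_)
open import Function.Definitions using (Injective)
open import Relation.Binary.Definitions using (Reflexive; Symmetric) renaming (Decidable to Decidable₂)
open import Relation.Binary.PropositionalEquality
open import Relation.Nullary using (¬_; ¬?; Dec; yes; no; contradiction)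
open import Relation.Nullary.Decidable using (map′; decidable-stable; toSum; _×-dec_; _⊎-dec_; _→-dec_)
open import Relation.Unary using (Decidable)

private
  variable
    d e g m n : ℕ

sum-const : ∀ n a → sum {n} (λ _ → a) ≡ n * a
sum-const zero    a = refl
sum-const (suc n) a = cong (a +_) (sum-const n a)

sum-zero : sum {n} (λ _ → 0) ≡ 0
sum-zero {n} = trans (sum-const n 0) (*-zeroʳ n)

sum-single : (f : Fin n → ℕ) (k : Fin n) → (∀ i → i ≢ k → f i ≡ 0) → sum f ≡ f k
sum-single {suc n} f zero    vanish = begin
  f zero + sum (f ∘ suc)      ≡⟨ cong (f zero +_) (sum-cong-≗ λ i → vanish (suc i) λ ()) ⟩
  f zero + sum {n} (λ _ → 0)  ≡⟨ cong (f zero +_) (sum-zero {n}) ⟩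
  f zero + 0                  ≡⟨ +-identityʳ _ ⟩
  f zero                      ∎
  where open ≡-Reasoning
sum-single {suc n} f (suc k) vanish = trans (cong (_+ sum (f ∘ suc)) (vanish zero λ ()))
  (sum-single (f ∘ suc) k λ i i≢k → vanish (suc i) (i≢k ∘ Fin.suc-injective))

term≤sum : (f : Fin n → ℕ) (i : Fin n) → f i ≤ sum f
term≤sum f zero    = m≤m+n _ _
term≤sum f (suc i) = ≤-trans (term≤sum (f ∘ suc) i) (m≤n+m _ _)

sum≡0⇒term≡0 : (f : Fin n → ℕ) → sum f ≡ 0 → ∀ i → f i ≡ 0
sum≡0⇒term≡0 f sum≡0 i = n≤0⇒n≡0 (subst (f i ≤_) sum≡0 (term≤sum f i))

sum≢0⇒∃term≢0 : (f : Fin n → ℕ) → sum f ≢ 0 → ∃ λ i → f i ≢ 0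
sum≢0⇒∃term≢0 {n} f sum≢0 =
  Fin.¬∀⟶∃¬ n (λ i → f i ≡ 0) (λ i → f i ≟ 0) λ all≡0 →
    sum≢0 (trans (sum-cong-≗ all≡0) (sum-zero {n}))

injective⇒surjective : (f : Fin n → Fin n) → Injective _≡_ _≡_ f → ∀ y → ∃ λ x → f x ≡ y
injective⇒surjective {suc n} f f-injective y with Fin.any? (λ x → f x Fin.≟ y)
... | yes hit  = hit
... | no  miss = contradiction (Fin.injective⇒≤ avoid-injective) 1+n≰n
  where
  y∉image : ∀ x → y ≢ f x
  y∉image x y≡fx = miss (x , sym y≡fx)
  avoid : Fin (suc n) → Fin n
  avoid x = punchOut (y∉image x)
  avoid-injective : Injective _≡_ _≡_ avoid
  avoid-injective eq = f-injective (Fin.punchOut-injective (y∉image _) (y∉image _) eq)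

injective⇒permutation : (f : Fin n → Fin n) → Injective _≡_ _≡_ f → Permutation′ n
injective⇒permutation f f-injective =
  permutation f (proj₁ ∘ onto) (proj₂ ∘ onto) (λ x → f-injective (proj₂ (onto (f x))))
  where onto = injective⇒surjective f f-injective

injective⇒≤length : {A : Set} {xs : List A} (f : Fin n → A) →
                    Injective _≡_ _≡_ f → (∀ i → f i ∈ xs) → n ≤ length xs
injective⇒≤length {xs = xs} f f-injective f∈xs = Fin.injective⇒≤ {f = index ∘ f∈xs} λ {i} {j} same-index →
  f-injective (trans (lookup-index (f∈xs i)) (trans (cong (List.lookup xs) same-index) (sym (lookup-index (f∈xs j)))))

minimal : {A : Set} (f : A → ℕ) {P : A → Set} → Decidable P → {x : A} {xs : List A} → x ∈ xs → P x →
          ∃ λ y → y ∈ xs × P y × (∀ {z} → z ∈ xs → P z → f y ≤ f z)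
minimal f P? {x} {xs} x∈xs px = y , proj₁ y-valid , proj₂ y-valid , λ z∈xs pz →
  All.lookup (f[argmin]≤f[xs] x (filter P? xs)) (∈-filter⁺ P? z∈xs pz)
  where
  y = argmin f x (filter P? xs)
  y-valid = argmin-all f (x∈xs , px) (All.tabulate (∈-filter⁻ P?))

lookup-ext : {x y : ℕ^ d} → (∀ i → lookup x i ≡ lookup y i) → x ≡ y
lookup-ext = Pointwise-≡⇒≡ ∘ ext

lookup-⊕ : (x y : ℕ^ d) (i : Fin d) → lookup (x ⊕ y) i ≡ lookup x i + lookup y i
lookup-⊕ x y i = lookup-zipWith _+_ i x y

lookup-𝟎 : (i : Fin d) → lookup 𝟎 i ≡ 0
lookup-𝟎 i = lookup-replicate i 0

axis : Fin d → ℕ → ℕ^ d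
axis i a = 𝟎 [ i ]≔ a

lookup-axis-≡ : (i : Fin d) (a : ℕ) → lookup (axis i a) i ≡ a
lookup-axis-≡ i a = lookup∘update i 𝟎 a

lookup-axis-≢ : {i k : Fin d} (a : ℕ) → i ≢ k → lookup (axis i a) k ≡ 0
lookup-axis-≢ {k = k} a i≢k = trans (lookup∘update′ (i≢k ∘ sym) 𝟎 a) (lookup-𝟎 k)

axis-⊕-update : (x : ℕ^ d) (i : Fin d) (a v : ℕ) → axis i a ⊕ (x [ i ]≔ v) ≡ x [ i ]≔ (a + v)
axis-⊕-update x i a v = lookup-ext λ k → trans (lookup-⊕ (axis i a) (x [ i ]≔ v) k) (coordinate k (i Fin.≟ k))
  where
  coordinate : ∀ k → Dec (i ≡ k) → lookup (axis i a) k + lookup (x [ i ]≔ v) k ≡ lookup (x [ i ]≔ (a + v)) k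
  coordinate k (yes refl) =
    trans (cong₂ _+_ (lookup-axis-≡ i a) (lookup∘update i x v)) (sym (lookup∘update i x _))
  coordinate k (no i≢k)   =
    trans (cong₂ _+_ (lookup-axis-≢ a i≢k) (lookup∘update′ (i≢k ∘ sym) x v))
          (sym (lookup∘update′ (i≢k ∘ sym) x _))

infixr 25 _·_

_·_ : ℕ → ℕ^ d → ℕ^ d
a · x = map (a *_) x

lookup-· : (a : ℕ) (x : ℕ^ d) (i : Fin d) → lookup (a · x) i ≡ a * lookup x i
lookup-· a x i = lookup-map i (a *_) x

∑ᵥ : (Fin n → ℕ^ d) → ℕ^ d
∑ᵥ F = tabulate λ j → sum λ i → lookup (F i) j

lookup-∑ᵥ : (F : Fin n → ℕ^ d) (j : Fin d) → lookup (∑ᵥ F) j ≡ sum (λ i → lookup (F i) j)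
lookup-∑ᵥ F j = lookup∘tabulate _ j

∑ᵥ-zero : (F : Fin 0 → ℕ^ d) → ∑ᵥ F ≡ 𝟎
∑ᵥ-zero F = lookup-ext λ j → trans (lookup-∑ᵥ F j) (sym (lookup-𝟎 j))

∑ᵥ-suc : (F : Fin (suc n) → ℕ^ d) → ∑ᵥ F ≡ F zero ⊕ ∑ᵥ (F ∘ suc)
∑ᵥ-suc F = lookup-ext λ j → begin
  lookup (∑ᵥ F) j                                          ≡⟨ lookup-∑ᵥ F j ⟩
  lookup (F zero) j + sum (λ i → lookup (F (suc i)) j)      ≡⟨ cong (lookup (F zero) j +_) (lookup-∑ᵥ (F ∘ suc) j) ⟨
  lookup (F zero) j + lookup (∑ᵥ (F ∘ suc)) j               ≡⟨ lookup-⊕ (F zero) _ j ⟨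
  lookup (F zero ⊕ ∑ᵥ (F ∘ suc)) j                          ∎
  where open ≡-Reasoning

∑ᵥ-cong : {F G : Fin n → ℕ^ d} → (∀ i → F i ≡ G i) → ∑ᵥ F ≡ ∑ᵥ G
∑ᵥ-cong F≡G = tabulate-cong λ j → sum-cong-≗ λ i → cong (λ x → lookup x j) (F≡G i)

·-as-∑ᵥ : (a : ℕ) (x : ℕ^ d) → a · x ≡ ∑ᵥ {a} (λ _ → x)
·-as-∑ᵥ a x = lookup-ext λ j →
  trans (lookup-· a x j) (sym (trans (lookup-∑ᵥ (λ (_ : Fin a) → x) j) (sum-const a (lookup x j))))

·-as-∑ᵥ-axis : (a : ℕ) (x : ℕ^ d) → a · x ≡ ∑ᵥ (λ i → lookup x i · axis i a)
·-as-∑ᵥ-axis a x = lookup-ext λ j → sym (begin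
  lookup (∑ᵥ (λ i → lookup x i · axis i a)) j      ≡⟨ lookup-∑ᵥ (λ i → lookup x i · axis i a) j ⟩
  sum (λ i → lookup (lookup x i · axis i a) j)     ≡⟨ sum-single _ j (off-axis j) ⟩
  lookup (lookup x j · axis j a) j                 ≡⟨ lookup-· (lookup x j) (axis j a) j ⟩
  lookup x j * lookup (axis j a) j                 ≡⟨ cong (lookup x j *_) (lookup-axis-≡ j a) ⟩
  lookup x j * a                                   ≡⟨ *-comm _ a ⟩
  a * lookup x j                                   ≡⟨ lookup-· a x j ⟨
  lookup (a · x) j                                 ∎)
  where
  open ≡-Reasoning
  off-axis : ∀ j i → i ≢ j → lookup (lookup x i · axis i a) j ≡ 0
  off-axis j i i≢j = trans (lookup-· (lookup x i) (axis i a) j)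
    (trans (cong (lookup x i *_) (lookup-axis-≢ a i≢j)) (*-zeroʳ (lookup x i)))

norm : ℕ^ d → ℕ
norm x = sum (lookup x)

norm-⊕ : (x y : ℕ^ d) → norm (x ⊕ y) ≡ norm x + norm y
norm-⊕ x y = trans (sum-cong-≗ (lookup-⊕ x y)) (∑-distrib-+ (lookup x) (lookup y))

norm-axis : (i : Fin d) (a : ℕ) → norm (axis i a) ≡ a
norm-axis i a = trans (sum-single (lookup (axis i a)) i λ k k≢i → lookup-axis-≢ a (k≢i ∘ sym)) (lookup-axis-≡ i a)

permute : Permutation′ d → ℕ^ d → ℕ^ d
permute π x = tabulate λ j → lookup x (π ⟨$⟩ʳ j)

lookup-permute : (π : Permutation′ d) (x : ℕ^ d) (j : Fin d) → lookup (permute π x) j ≡ lookup x (π ⟨$⟩ʳ j)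
lookup-permute π x j = lookup∘tabulate _ j

permute-⊕ : (π : Permutation′ d) (x y : ℕ^ d) → permute π (x ⊕ y) ≡ permute π x ⊕ permute π y
permute-⊕ π x y = lookup-ext λ j → begin
  lookup (permute π (x ⊕ y)) j                      ≡⟨ lookup-permute π (x ⊕ y) j ⟩
  lookup (x ⊕ y) (π ⟨$⟩ʳ j)                          ≡⟨ lookup-⊕ x y _ ⟩
  lookup x (π ⟨$⟩ʳ j) + lookup y (π ⟨$⟩ʳ j)          ≡⟨ cong₂ _+_ (lookup-permute π x j) (lookup-permute π y j) ⟨
  lookup (permute π x) j + lookup (permute π y) j   ≡⟨ lookup-⊕ (permute π x) _ j ⟨
  lookup (permute π x ⊕ permute π y) j              ∎
  where open ≡-Reasoning

permute-𝟎 : (π : Permutation′ d) → permute π 𝟎 ≡ 𝟎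
permute-𝟎 π = lookup-ext λ j →
  trans (lookup-permute π 𝟎 j) (trans (lookup-𝟎 (π ⟨$⟩ʳ j)) (sym (lookup-𝟎 j)))

permute-∘ : (π σ : Permutation′ d) (x : ℕ^ d) → permute σ (permute π x) ≡ permute (σ ∘ₚ π) x
permute-∘ π σ x = lookup-ext λ j →
  trans (lookup-permute σ (permute π x) j)
        (trans (lookup-permute π x (σ ⟨$⟩ʳ j)) (sym (lookup-permute (σ ∘ₚ π) x j)))

permute-cong : {π σ : Permutation′ d} → π ≈ₚ σ → (x : ℕ^ d) → permute π x ≡ permute σ x
permute-cong π≈σ x = tabulate-cong λ j → cong (lookup x) (π≈σ j)

permute-id : (x : ℕ^ d) → permute idₚ x ≡ x
permute-id x = lookup-ext (lookup-permute idₚ x)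

permute-flip-permute : (π : Permutation′ d) (x : ℕ^ d) → permute (flip π) (permute π x) ≡ x
permute-flip-permute π x = lookup-ext λ j → trans (lookup-permute (flip π) (permute π x) j)
  (trans (lookup-permute π x (flip π ⟨$⟩ʳ j)) (cong (lookup x) (inverseʳ π)))

permute-permute-flip : (π : Permutation′ d) (x : ℕ^ d) → permute π (permute (flip π) x) ≡ x
permute-permute-flip π x = permute-flip-permute (flip π) x

permute-injective : (π : Permutation′ d) {x y : ℕ^ d} → permute π x ≡ permute π y → x ≡ y
permute-injective π {x} {y} eq =
  trans (sym (permute-flip-permute π x)) (trans (cong (permute (flip π)) eq) (permute-flip-permute π y))

transpose-matchˡ : (i j : Fin n) → transpose i j ⟨$⟩ʳ i ≡ j
transpose-matchˡ i j with i Fin.≟ i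
... | yes _   = refl
... | no  i≢i = contradiction refl i≢i

transpose-matchʳ : (i j : Fin n) → transpose i j ⟨$⟩ʳ j ≡ i
transpose-matchʳ i j with j Fin.≟ i
... | yes j≡i = j≡i
... | no  _ with j Fin.≟ j
...   | yes _   = refl
...   | no  j≢j = contradiction refl j≢j

permute-transpose : (x : ℕ^ d) {i j : Fin d} → lookup x i ≡ lookup x j → permute (transpose i j) x ≡ x
permute-transpose x {i} {j} xᵢ≡xⱼ = lookup-ext λ k → trans (lookup-permute (transpose i j) x k) (swapped k)
  where
  swapped : ∀ k → lookup x (transpose i j ⟨$⟩ʳ k) ≡ lookup x k
  swapped k with k Fin.≟ i
  ... | yes refl = sym xᵢ≡xⱼ
  ... | no  _ with k Fin.≟ j
  ...   | yes refl = xᵢ≡xⱼ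
  ...   | no  _    = refl

-- Gaps

_∈?_ : (x : ℕ^ d) (xs : List (ℕ^ d)) → Dec (x ∈ xs)
_∈?_ = DecMembership._∈?_ (≡-dec _≟_)

module _ (S : GNS d g) where

  ¬∈S⇒gap : {x : ℕ^ d} → ¬ x ∈S S → x ∈ gaps S
  ¬∈S⇒gap {x} = decidable-stable (x ∈? gaps S)

  gap-summand : {y z : ℕ^ d} → y ∈S S → (y ⊕ z) ∈ gaps S → z ∈ gaps S
  gap-summand y∈S y⊕z∈H = ¬∈S⇒gap λ z∈S → closed S _ _ y∈S z∈S y⊕z∈H

  ∑ᵥ-∈S : (F : Fin n → ℕ^ d) → (∀ i → F i ∈S S) → ∑ᵥ F ∈S S
  ∑ᵥ-∈S {zero}  F F∈S = subst (_∈S S) (sym (∑ᵥ-zero F)) (zero∈S S)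
  ∑ᵥ-∈S {suc n} F F∈S =
    subst (_∈S S) (sym (∑ᵥ-suc F)) (closed S _ _ (F∈S zero) (∑ᵥ-∈S (F ∘ suc) (F∈S ∘ suc)))

  ·-∈S : (a : ℕ) {x : ℕ^ d} → x ∈S S → a · x ∈S S
  ·-∈S a {x} x∈S = subst (_∈S S) (sym (·-as-∑ᵥ a x)) (∑ᵥ-∈S {n = a} (λ _ → x) (λ _ → x∈S))

  gaps-injective⇒≤genus : (f : Fin n → ℕ^ d) → Injective _≡_ _≡_ f → (∀ i → f i ∈ gaps S) → n ≤ g
  gaps-injective⇒≤genus f f-injective f∈H = subst (_ ≤_) (genus S) (injective⇒≤length f f-injective f∈H)

  axis-multiple-∈S : (i : Fin d) → ∃ λ a → a ≤ g × axis i (suc a) ∈S S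
  axis-multiple-∈S i with Fin.any? (λ (a : Fin (suc g)) → ¬? (axis i (suc (toℕ a)) ∈? gaps S))
  ... | yes (a , a∈S) = toℕ a , Fin.toℕ≤pred[n] a , a∈S
  ... | no none = contradiction (gaps-injective⇒≤genus multiple multiple-injective multiple∈H) 1+n≰n
    where
    multiple : Fin (suc g) → ℕ^ d
    multiple a = axis i (suc (toℕ a))
    multiple-injective : Injective _≡_ _≡_ multiple
    multiple-injective {a} {b} eq = Fin.toℕ-injective (suc-injective
      (trans (sym (lookup-axis-≡ i _)) (trans (cong (λ x → lookup x i) eq) (lookup-axis-≡ i _))))
    multiple∈H : ∀ a → multiple a ∈ gaps S
    multiple∈H a = ¬∈S⇒gap λ a∈S → none (a , a∈S)

  gap-∸-multiples : {i : Fin d} {a : ℕ} {x : ℕ^ d} → axis i a ∈S S → x ∈ gaps S →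
                    ∀ t → t * a ≤ lookup x i → x [ i ]≔ (lookup x i ∸ t * a) ∈ gaps S
  gap-∸-multiples {i} {a} {x} a∈S x∈H zero _ = subst (_∈ gaps S) (sym ([]≔-lookup x i)) x∈H
  gap-∸-multiples {i} {a} {x} a∈S x∈H (suc t) a+ta≤xᵢ = gap-summand a∈S (subst (_∈ gaps S) previous
    (gap-∸-multiples a∈S x∈H t (m+n≤o⇒n≤o a a+ta≤xᵢ)))
    where
    restore : a + (lookup x i ∸ (a + t * a)) ≡ lookup x i ∸ t * a
    restore = begin
      a + (lookup x i ∸ (a + t * a))   ≡⟨ cong (λ n → a + (lookup x i ∸ n)) (+-comm a (t * a)) ⟩
      a + (lookup x i ∸ (t * a + a))   ≡⟨ cong (a +_) (∸-+-assoc (lookup x i) (t * a) a) ⟨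
      a + (lookup x i ∸ t * a ∸ a)     ≡⟨ m+[n∸m]≡n (m+n≤o⇒m≤o∸n a a+ta≤xᵢ) ⟩
      lookup x i ∸ t * a               ∎
      where open ≡-Reasoning
    previous : x [ i ]≔ (lookup x i ∸ t * a) ≡ axis i a ⊕ (x [ i ]≔ (lookup x i ∸ suc t * a))
    previous = trans (cong (x [ i ]≔_) (sym restore)) (sym (axis-⊕-update x i a _))

  gap-coordinate-bound : {x : ℕ^ d} → x ∈ gaps S → (i : Fin d) → lookup x i < g * suc g
  gap-coordinate-bound {x} x∈H i with axis-multiple-∈S i
  ... | a , a≤g , a∈S with g * suc a ≤? lookup x i
  ...   | no  xᵢ<g[1+a] = <-≤-trans (≰⇒> xᵢ<g[1+a]) (*-monoʳ-≤ g (s≤s a≤g))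
  ...   | yes g[1+a]≤xᵢ = contradiction (gaps-injective⇒≤genus descent descent-injective descent∈H) 1+n≰n
    where
    bounded : (t : Fin (suc g)) → toℕ t * suc a ≤ lookup x i
    bounded t = ≤-trans (*-monoˡ-≤ (suc a) (Fin.toℕ≤pred[n] t)) g[1+a]≤xᵢ
    descent : Fin (suc g) → ℕ^ d
    descent t = x [ i ]≔ (lookup x i ∸ toℕ t * suc a)
    descent-injective : Injective _≡_ _≡_ descent
    descent-injective {t} {u} eq = Fin.toℕ-injective (*-cancelʳ-≡ _ _ (suc a)
      (∸-cancelˡ-≡ (bounded t) (bounded u)
        (trans (sym (lookup∘update i x _)) (trans (cong (λ y → lookup y i) eq) (lookup∘update i x _)))))
    descent∈H : ∀ t → descent t ∈ gaps S
    descent∈H t = gap-∸-multiples a∈S x∈H (toℕ t) (bounded t)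

-- Isomorphisms are permutations of coordinates

record _≅ₚ_ (S T : GNS d g) : Set where
  field
    perm          : Permutation′ d
    preserves-gap : {x : ℕ^ d} → x ∈ gaps S → permute perm x ∈ gaps T
    reflects-gap  : {x : ℕ^ d} → permute perm x ∈ gaps T → x ∈ gaps S

open _≅ₚ_

gaps≡⇒≅ₚ : {S T : GNS d g} → gaps S ≡ gaps T → S ≅ₚ T
gaps≡⇒≅ₚ {S = S} {T} S≡T = record
  { perm          = idₚ
  ; preserves-gap = λ {x} x∈S → subst (_∈ gaps T) (sym (permute-id x)) (subst (x ∈_) S≡T x∈S)
  ; reflects-gap  = λ {x} x∈T → subst (x ∈_) (sym S≡T) (subst (_∈ gaps T) (permute-id x) x∈T)
  }

≅ₚ-refl : {S : GNS d g} → S ≅ₚ S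
≅ₚ-refl = gaps≡⇒≅ₚ refl

≅ₚ-sym : {S T : GNS d g} → S ≅ₚ T → T ≅ₚ S
≅ₚ-sym {S = S} {T} S≅T = record
  { perm          = flip π
  ; preserves-gap = λ {y} y∈T → reflects-gap S≅T (subst (_∈ gaps T) (sym (permute-permute-flip π y)) y∈T)
  ; reflects-gap  = λ {y} y′∈S → subst (_∈ gaps T) (permute-permute-flip π y) (preserves-gap S≅T y′∈S)
  }
  where π = perm S≅T

≅ₚ-trans : {S T U : GNS d g} → S ≅ₚ T → T ≅ₚ U → S ≅ₚ U
≅ₚ-trans {U = U} S≅T T≅U = record
  { perm          = σ ∘ₚ π
  ; preserves-gap = λ {x} x∈S →
      subst (_∈ gaps U) (permute-∘ π σ x) (preserves-gap T≅U (preserves-gap S≅T x∈S))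
  ; reflects-gap  = λ {x} x′∈U →
      reflects-gap S≅T (reflects-gap T≅U (subst (_∈ gaps U) (sym (permute-∘ π σ x)) x′∈U))
  }
  where
  π = perm S≅T
  σ = perm T≅U

≅ₚ⇒Iso : {S T : GNS d g} → S ≅ₚ T → Iso S T
≅ₚ⇒Iso {S = S} {T} S≅T = record
  { fun        = λ x _ → permute π x
  ; fun-irr    = λ _ _ _ → refl
  ; fun-into   = λ x x∈S πx∈T → x∈S (reflects-gap S≅T πx∈T)
  ; hom-zero   = λ _ → permute-𝟎 π
  ; hom-plus   = λ x y _ _ _ → permute-⊕ π x y
  ; injective  = λ x y _ _ → permute-injective π
  ; surjective = λ z z∈T → permute (flip π) z
                         , (λ z′∈S → z∈T (subst (_∈ gaps T) (permute-permute-flip π z)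
                                                  (preserves-gap S≅T z′∈S)))
                         , permute-permute-flip π z
  }
  where π = perm S≅T

module _ {S : GNS d g} {T : GNS e m} (φ : Iso S T) where
  open Iso φ

  fun-cong : {x y : ℕ^ d} → x ≡ y → (p : x ∈S S) (q : y ∈S S) → fun x p ≡ fun y q
  fun-cong refl p q = fun-irr _ p q

  fun-∑ᵥ : (F : Fin n → ℕ^ d) (p : ∀ i → F i ∈S S) (q : ∑ᵥ F ∈S S) →
           fun (∑ᵥ F) q ≡ ∑ᵥ (λ i → fun (F i) (p i))
  fun-∑ᵥ {zero}  F p q = begin
    fun (∑ᵥ F) q                ≡⟨ fun-cong (∑ᵥ-zero F) q (zero∈S S) ⟩
    fun 𝟎 (zero∈S S)            ≡⟨ hom-zero (zero∈S S) ⟩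
    𝟎                           ≡⟨ ∑ᵥ-zero (λ i → fun (F i) (p i)) ⟨
    ∑ᵥ (λ i → fun (F i) (p i))  ∎
    where open ≡-Reasoning
  fun-∑ᵥ {suc n} F p q = begin
    fun (∑ᵥ F) q                                        ≡⟨ fun-cong (∑ᵥ-suc F) q F₀⊕rest∈S ⟩
    fun (F zero ⊕ ∑ᵥ (F ∘ suc)) F₀⊕rest∈S               ≡⟨ hom-plus _ _ (p zero) rest∈S F₀⊕rest∈S ⟩
    fun (F zero) (p zero) ⊕ fun (∑ᵥ (F ∘ suc)) rest∈S   ≡⟨ cong (_ ⊕_) (fun-∑ᵥ (F ∘ suc) (p ∘ suc) rest∈S) ⟩
    fun (F zero) (p zero) ⊕ ∑ᵥ (λ i → fun (F (suc i)) (p (suc i)))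
                                                        ≡⟨ ∑ᵥ-suc (λ i → fun (F i) (p i)) ⟨
    ∑ᵥ (λ i → fun (F i) (p i))                          ∎
    where
    open ≡-Reasoning
    rest∈S = ∑ᵥ-∈S S (F ∘ suc) (p ∘ suc)
    F₀⊕rest∈S = closed S _ _ (p zero) rest∈S

  fun-· : (a : ℕ) {x : ℕ^ d} (p : x ∈S S) (q : a · x ∈S S) → fun (a · x) q ≡ a · fun x p
  fun-· a {x} p q = begin
    fun (a · x) q                       ≡⟨ fun-cong (·-as-∑ᵥ a x) q r ⟩
    fun (∑ᵥ {a} (λ _ → x)) r            ≡⟨ fun-∑ᵥ {n = a} (λ _ → x) (λ _ → p) r ⟩
    ∑ᵥ {a} (λ _ → fun x p)              ≡⟨ ·-as-∑ᵥ a (fun x p) ⟨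
    a · fun x p                         ∎
    where
    open ≡-Reasoning
    r = ∑ᵥ-∈S S {n = a} (λ _ → x) (λ _ → p)

module Rigidity {S T : GNS d g} (φ : Iso S T) where
  open Iso φ

  K : ℕ
  K = suc (g * suc g)

  SingleSupport : ℕ^ d → Fin d → Set
  SingleSupport v j = lookup v j ≢ 0 × (∀ k → k ≢ j → lookup v k ≡ 0)

  axis-∈S : (U : GNS d g) (i : Fin d) {a : ℕ} → K ≤ a → axis i a ∈S U
  axis-∈S U i {a} K≤a a∈H =
    <⇒≱ (gap-coordinate-bound U a∈H i) (≤-trans (n≤1+n _) (subst (K ≤_) (sym (lookup-axis-≡ i a)) K≤a))

  φKe : Fin d → ℕ^ d
  φKe i = fun (axis i K) (axis-∈S S i ≤-refl)

  K·fun : (x : ℕ^ d) (p : x ∈S S) → K · fun x p ≡ ∑ᵥ (λ i → lookup x i · φKe i)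
  K·fun x p = begin
    K · fun x p                      ≡⟨ fun-· φ K p (·-∈S S K p) ⟨
    fun (K · x) (·-∈S S K p)         ≡⟨ fun-cong φ (·-as-∑ᵥ-axis K x) _ ∑F∈S ⟩
    fun (∑ᵥ F) ∑F∈S                  ≡⟨ fun-∑ᵥ φ F F∈S ∑F∈S ⟩
    ∑ᵥ (λ i → fun (F i) (F∈S i))     ≡⟨ ∑ᵥ-cong (λ i → fun-· φ (lookup x i) (axis-∈S S i ≤-refl) (F∈S i)) ⟩
    ∑ᵥ (λ i → lookup x i · φKe i)    ∎
    where
    open ≡-Reasoning
    F : Fin d → ℕ^ d
    F i = lookup x i · axis i K
    F∈S : ∀ i → F i ∈S S
    F∈S i = ·-∈S S (lookup x i) (axis-∈S S i ≤-refl)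
    ∑F∈S = ∑ᵥ-∈S S F F∈S

  K*fun : (x : ℕ^ d) (p : x ∈S S) (j : Fin d) →
          K * lookup (fun x p) j ≡ sum (λ i → lookup x i * lookup (φKe i) j)
  K*fun x p j = begin
    K * lookup (fun x p) j                        ≡⟨ lookup-· K (fun x p) j ⟨
    lookup (K · fun x p) j                        ≡⟨ cong (λ y → lookup y j) (K·fun x p) ⟩
    lookup (∑ᵥ (λ i → lookup x i · φKe i)) j      ≡⟨ lookup-∑ᵥ (λ i → lookup x i · φKe i) j ⟩
    sum (λ i → lookup (lookup x i · φKe i) j)     ≡⟨ sum-cong-≗ (λ i → lookup-· (lookup x i) (φKe i) j) ⟩
    sum (λ i → lookup x i * lookup (φKe i) j)     ∎
    where open ≡-Reasoning

  column-support : (j : Fin d) → ∃ λ i → SingleSupport (φKe i) j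
  column-support j = from-preimage (surjective (axis j K) (axis-∈S T j ≤-refl))
    where
    from-preimage : (∃ λ x → ∃ λ (p : x ∈S S) → fun x p ≡ axis j K) → ∃ λ i → SingleSupport (φKe i) j
    from-preimage (x , p , φx≡Kj) = i , φKeᵢⱼ≢0 , off-support
      where
      image : ∀ k → K * lookup (axis j K) k ≡ sum (λ i → lookup x i * lookup (φKe i) k)
      image k = trans (cong (λ y → K * lookup y k) (sym φx≡Kj)) (K*fun x p k)
      hit : ∃ λ i → lookup x i * lookup (φKe i) j ≢ 0
      hit = sum≢0⇒∃term≢0 (λ i → lookup x i * lookup (φKe i) j) λ sum≡0 →
        0≢1+n (sym (trans (cong (K *_) (sym (lookup-axis-≡ j K))) (trans (image j) sum≡0)))
      i : Fin d
      i = proj₁ hit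
      xᵢ≢0 : lookup x i ≢ 0
      xᵢ≢0 xᵢ≡0 = proj₂ hit (cong (_* lookup (φKe i) j) xᵢ≡0)
      φKeᵢⱼ≢0 : lookup (φKe i) j ≢ 0
      φKeᵢⱼ≢0 φKeᵢⱼ≡0 = proj₂ hit (trans (cong (lookup x i *_) φKeᵢⱼ≡0) (*-zeroʳ (lookup x i)))
      term-vanishes : ∀ k → k ≢ j → lookup x i * lookup (φKe i) k ≡ 0
      term-vanishes k k≢j = sum≡0⇒term≡0 (λ i → lookup x i * lookup (φKe i) k)
        (trans (sym (image k)) (trans (cong (K *_) (lookup-axis-≢ K (k≢j ∘ sym))) (*-zeroʳ K))) i
      off-support : ∀ k → k ≢ j → lookup (φKe i) k ≡ 0
      off-support k k≢j =
        fromInj₂ (λ xᵢ≡0 → contradiction xᵢ≡0 xᵢ≢0) (m*n≡0⇒m≡0∨n≡0 (lookup x i) (term-vanishes k k≢j))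

  ρ : Fin d → Fin d
  ρ j = proj₁ (column-support j)

  ρ-injective : ∀ {j j′} → ρ j ≡ ρ j′ → j ≡ j′
  ρ-injective {j} {j′} ρj≡ρj′ = decidable-stable (j Fin.≟ j′) λ j≢j′ → proj₁ (proj₂ (column-support j))
    (subst (λ i → lookup (φKe i) j ≡ 0) (sym ρj≡ρj′) (proj₂ (proj₂ (column-support j′)) j j≢j′))

  π : Permutation′ d
  π = injective⇒permutation ρ ρ-injective

  φKe-off-diagonal : ∀ i j → i ≢ ρ j → lookup (φKe i) j ≡ 0
  φKe-off-diagonal i j i≢ρj = subst (λ i → lookup (φKe i) j ≡ 0) (inverseʳ π)
    (proj₂ (proj₂ (column-support (π ⟨$⟩ˡ i))) j λ j≡π⁻¹i →
      i≢ρj (trans (sym (inverseʳ π)) (cong ρ (sym j≡π⁻¹i))))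

  diagonal : Fin d → ℕ
  diagonal j = lookup (φKe (ρ j)) j

  K*fun-diagonal : (x : ℕ^ d) (p : x ∈S S) (j : Fin d) →
                   K * lookup (fun x p) j ≡ lookup x (ρ j) * diagonal j
  K*fun-diagonal x p j = trans (K*fun x p j) (sum-single _ (ρ j) λ i i≢ρj →
    trans (cong (lookup x i *_) (φKe-off-diagonal i j i≢ρj)) (*-zeroʳ (lookup x i)))

  K∣diagonal : ∀ j → K ∣ diagonal j
  K∣diagonal j = ∣m+n∣m⇒∣n (subst (K ∣_) image (m∣m*n _)) (m∣m*n (diagonal j))
    where
    p = axis-∈S S (ρ j) (n≤1+n K)
    image : K * lookup (fun (axis (ρ j) (suc K)) p) j ≡ K * diagonal j + diagonal j
    image = begin
      K * lookup (fun (axis (ρ j) (suc K)) p) j           ≡⟨ K*fun-diagonal _ p j ⟩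
      lookup (axis (ρ j) (suc K)) (ρ j) * diagonal j      ≡⟨ cong (_* diagonal j) (lookup-axis-≡ (ρ j) (suc K)) ⟩
      diagonal j + K * diagonal j                         ≡⟨ +-comm (diagonal j) _ ⟩
      K * diagonal j + diagonal j                         ∎
      where open ≡-Reasoning

  scale : Fin d → ℕ
  scale j = quotient (K∣diagonal j)

  fun-coordinate : (x : ℕ^ d) (p : x ∈S S) (j : Fin d) → lookup (fun x p) j ≡ lookup x (ρ j) * scale j
  fun-coordinate x p j = *-cancelˡ-≡ _ _ K (begin
    K * lookup (fun x p) j              ≡⟨ K*fun-diagonal x p j ⟩
    lookup x (ρ j) * diagonal j         ≡⟨ cong (lookup x (ρ j) *_) (_∣_.equality (K∣diagonal j)) ⟩
    lookup x (ρ j) * (scale j * K)      ≡⟨ *-assoc (lookup x (ρ j)) (scale j) K ⟨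
    lookup x (ρ j) * scale j * K        ≡⟨ *-comm _ K ⟩
    K * (lookup x (ρ j) * scale j)      ∎)
    where open ≡-Reasoning

  scale∣large : ∀ j {a} → K ≤ a → scale j ∣ a
  scale∣large j {a} K≤a = from-preimage (surjective (axis j a) (axis-∈S T j K≤a))
    where
    from-preimage : (∃ λ x → ∃ λ (p : x ∈S S) → fun x p ≡ axis j a) → scale j ∣ a
    from-preimage (x , p , φx≡a) = divides (lookup x (ρ j)) (begin
      a                           ≡⟨ lookup-axis-≡ j a ⟨
      lookup (axis j a) j         ≡⟨ cong (λ y → lookup y j) φx≡a ⟨
      lookup (fun x p) j          ≡⟨ fun-coordinate x p j ⟩
      lookup x (ρ j) * scale j    ∎)
      where open ≡-Reasoning

  scale≡1 : ∀ j → scale j ≡ 1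
  scale≡1 j =
    ∣1⇒≡1 (∣m+n∣m⇒∣n (subst (scale j ∣_) (+-comm 1 K) (scale∣large j (n≤1+n K))) (scale∣large j ≤-refl))

  fun≡permute : (x : ℕ^ d) (p : x ∈S S) → fun x p ≡ permute π x
  fun≡permute x p = lookup-ext λ j → begin
    lookup (fun x p) j          ≡⟨ fun-coordinate x p j ⟩
    lookup x (ρ j) * scale j    ≡⟨ cong (lookup x (ρ j) *_) (scale≡1 j) ⟩
    lookup x (ρ j) * 1          ≡⟨ *-identityʳ _ ⟩
    lookup x (ρ j)              ≡⟨ lookup-permute π x j ⟨
    lookup (permute π x) j      ∎
    where open ≡-Reasoning

  π-preserves-gap : {x : ℕ^ d} → x ∈ gaps S → permute π x ∈ gaps T
  π-preserves-gap {x} x∈H = ¬∈S⇒gap T λ πx∈T →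
    let (x′ , x′∈S , φx′≡πx) = surjective (permute π x) πx∈T
    in  x′∈S (subst (_∈ gaps S) (permute-injective π (trans (sym φx′≡πx) (fun≡permute x′ x′∈S))) x∈H)

  ≅ₚ : S ≅ₚ T
  ≅ₚ = record
    { perm          = π
    ; preserves-gap = π-preserves-gap
    ; reflects-gap  = λ {x} πx∈H → ¬∈S⇒gap S λ x∈S →
        fun-into x x∈S (subst (_∈ gaps T) (sym (fun≡permute x x∈S)) πx∈H)
    }

Iso⇒≅ₚ : {S T : GNS d g} → Iso S T → S ≅ₚ T
Iso⇒≅ₚ = Rigidity.≅ₚ

-- Finitely many isomorphism classes

module _ {A : Set} where

  vectors : List A → (n : ℕ) → List (Vec A n)
  vectors xs zero    = [] ∷ᴸ []ᴸ
  vectors xs (suc n) = List.cartesianProductWith _∷_ xs (vectors xs n)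

  ∈-vectors : {xs : List A} (v : Vec A n) → (∀ i → lookup v i ∈ xs) → v ∈ vectors xs n
  ∈-vectors []      _  = here refl
  ∈-vectors (a ∷ v) v∈ = ∈-cartesianProductWith⁺ _∷_ (v∈ zero) (∈-vectors v (v∈ ∘ suc))

  lists : List A → ℕ → List (List A)
  lists xs zero    = []ᴸ ∷ᴸ []ᴸ
  lists xs (suc n) = List.cartesianProductWith _∷ᴸ_ xs (lists xs n)

  ∈-lists : {xs ys : List A} → All (_∈ xs) ys → ys ∈ lists xs (length ys)
  ∈-lists []ᴬ         = here refl
  ∈-lists (y∈ ∷ᴬ ys∈) = ∈-cartesianProductWith⁺ _∷ᴸ_ y∈ (∈-lists ys∈)

  select : {P : A → Set} → Decidable P → List A → List (Σ A P)
  select P? []ᴸ = []ᴸ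
  select P? (x ∷ᴸ xs) with P? x
  ... | yes px = (x , px) ∷ᴸ select P? xs
  ... | no  _  = select P? xs

  ∈-select : {P : A → Set} (P? : Decidable P) {x : A} {xs : List A} →
             x ∈ xs → P x → ∃ λ px → (x , px) ∈ select P? xs
  ∈-select P? {xs = y ∷ᴸ ys} (here refl) px with P? y
  ... | yes py = py , here refl
  ... | no ¬py = contradiction px ¬py
  ∈-select P? {xs = y ∷ᴸ ys} (there x∈ys) px with P? y
  ... | yes _ = let (q , x∈) = ∈-select P? x∈ys px in q , there x∈
  ... | no  _ = ∈-select P? x∈ys px

module Candidates (d g : ℕ) where

  box : List (ℕ^ d)
  box = vectors (upTo (g * suc g)) d

  InBox : ℕ^ d → Set
  InBox x = ∀ i → lookup x i < g * suc g

  ∈-box : {x : ℕ^ d} → InBox x → x ∈ box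
  ∈-box {x} x-in = ∈-vectors x (λ i → ∈-upTo⁺ (x-in i))

  -- Closedness only needs checking inside the box: both summands of a gap are coordinatewise below it.
  IsGapList : List (ℕ^ d) → Set
  IsGapList G = length G ≡ g × Unique G × 𝟎 ∉ G × All InBox G
              × All (λ x → All (λ y → (x ⊕ y) ∈ G → x ∈ G ⊎ y ∈ G) box) box

  isGapList? : Decidable IsGapList
  isGapList? G = length G ≟ g ×-dec unique? G ×-dec ¬? (𝟎 ∈? G)
    ×-dec All.all? (λ x → Fin.all? λ i → lookup x i <? g * suc g) G
    ×-dec All.all? (λ x → All.all? (λ y → (x ⊕ y) ∈? G →-dec (x ∈? G ⊎-dec y ∈? G)) box) box
    where open DecUnique (≡-dec _≟_) using (unique?)

  toGNS : Σ (List (ℕ^ d)) IsGapList → GNS d g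
  toGNS (G , length≡g , unique , 𝟎∉G , inBox , summands) = record
    { gaps = G ; gapsUnique = unique ; genus = length≡g ; zero∈S = 𝟎∉G ; closed = closed′ }
    where
    closed′ : ∀ x y → x ∉ G → y ∉ G → (x ⊕ y) ∉ G
    closed′ x y x∉G y∉G x⊕y∈G =
      [ x∉G , y∉G ]′ (All.lookup (All.lookup summands (∈-box x-in)) (∈-box y-in) x⊕y∈G)
      where
      x-in : InBox x
      x-in i = ≤-<-trans (subst (lookup x i ≤_) (sym (lookup-⊕ x y i)) (m≤m+n _ _))
                         (All.lookup inBox x⊕y∈G i)
      y-in : InBox y
      y-in i = ≤-<-trans (subst (lookup y i ≤_) (sym (lookup-⊕ x y i)) (m≤n+m _ _))
                         (All.lookup inBox x⊕y∈G i)

  candidates : List (GNS d g)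
  candidates = List.map toGNS (select isGapList? (lists box g))

  candidate-with-gaps : (S : GNS d g) → ∃ λ C → C ∈ candidates × gaps C ≡ gaps S
  candidate-with-gaps S = toGNS (gaps S , proj₁ selected) , ∈-map⁺ toGNS (proj₂ selected) , refl
    where
    summand-gap : ∀ x y → (x ⊕ y) ∈ gaps S → x ∈ gaps S ⊎ y ∈ gaps S
    summand-gap x y x⊕y∈H = Sum.map₂ (λ x∈S → gap-summand S x∈S x⊕y∈H) (toSum (x ∈? gaps S))
    is-gap-list : IsGapList (gaps S)
    is-gap-list = genus S , gapsUnique S , zero∈S S , All.tabulate (gap-coordinate-bound S)
                , All.tabulate (λ {x} _ → All.tabulate (λ {y} _ → summand-gap x y))
    listed : gaps S ∈ lists box g
    listed = subst (λ n → gaps S ∈ lists box n) (genus S)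
      (∈-lists (All.tabulate (λ x∈H → ∈-box (gap-coordinate-bound S x∈H))))
    selected = ∈-select isGapList? listed is-gap-list

injective? : (f : Fin n → Fin m) → Dec (Injective _≡_ _≡_ f)
injective? f = map′ (λ inj {i} {j} → inj i j) (λ inj i j → inj)
  (Fin.all? λ i → Fin.all? λ j → f i Fin.≟ f j →-dec i Fin.≟ j)

permutations : (n : ℕ) → List (Permutation′ n)
permutations n = List.map (λ (ρ , ρ-injective) → injective⇒permutation (lookup ρ) ρ-injective)
  (select {P = Injective _≡_ _≡_ ∘ lookup} (injective? ∘ lookup) (vectors (allFin n) n))

∈-permutations : (π : Permutation′ n) → ∃ λ σ → σ ∈ permutations n × σ ≈ₚ π
∈-permutations {n} π =
  injective⇒permutation (lookup ρ) (proj₁ selected) , ∈-map⁺ _ (proj₂ selected) , lookup∘tabulate _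
  where
  ρ = tabulate (π ⟨$⟩ʳ_)
  ρ-injective : Injective _≡_ _≡_ (lookup ρ)
  ρ-injective {i} {j} eq = begin
    i                        ≡⟨ inverseˡ π ⟨
    π ⟨$⟩ˡ (π ⟨$⟩ʳ i)        ≡⟨ cong (π ⟨$⟩ˡ_) (trans (sym (lookup∘tabulate _ i)) (trans eq (lookup∘tabulate _ j))) ⟩
    π ⟨$⟩ˡ (π ⟨$⟩ʳ j)        ≡⟨ inverseˡ π ⟩
    j                        ∎
    where open ≡-Reasoning
  selected = ∈-select {P = Injective _≡_ _≡_ ∘ lookup} (injective? ∘ lookup)
    (∈-vectors ρ (λ i → ∈-allFin _)) ρ-injective

≅ₚ-resp-≈ₚ : {S T : GNS d g} (S≅T : S ≅ₚ T) {σ : Permutation′ d} → σ ≈ₚ perm S≅T → S ≅ₚ T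
≅ₚ-resp-≈ₚ {T = T} S≅T {σ} σ≈π = record
  { perm          = σ
  ; preserves-gap = λ {x} x∈S → subst (_∈ gaps T) (sym (σx≡πx x)) (preserves-gap S≅T x∈S)
  ; reflects-gap  = λ {x} σx∈T → reflects-gap S≅T (subst (_∈ gaps T) (σx≡πx x) σx∈T)
  }
  where
  σx≡πx : ∀ x → permute σ x ≡ permute (perm S≅T) x
  σx≡πx = permute-cong {π = σ} {perm S≅T} σ≈π

module _ (S T : GNS d g) where

  Matches : Permutation′ d → Set
  Matches π = All (λ x → permute π x ∈ gaps T) (gaps S) × All (λ y → permute (flip π) y ∈ gaps S) (gaps T)

  matches? : Decidable Matches
  matches? π = All.all? (λ x → permute π x ∈? gaps T) (gaps S)
         ×-dec All.all? (λ y → permute (flip π) y ∈? gaps S) (gaps T)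

  matches⇒≅ₚ : {π : Permutation′ d} → Matches π → S ≅ₚ T
  matches⇒≅ₚ {π} (forward , backward) = record
    { perm          = π
    ; preserves-gap = All.lookup forward
    ; reflects-gap  = λ {x} πx∈T → subst (_∈ gaps S) (permute-flip-permute π x) (All.lookup backward πx∈T)
    }

  ≅ₚ⇒matches : (S≅T : S ≅ₚ T) → Matches (perm S≅T)
  ≅ₚ⇒matches S≅T = All.tabulate (preserves-gap S≅T) , All.tabulate (preserves-gap (≅ₚ-sym S≅T))

  _≅ₚ?_ : Dec (S ≅ₚ T)
  _≅ₚ?_ = map′ matched found (Any.any? matches? (permutations d))
    where
    matched : Any Matches (permutations d) → S ≅ₚ T
    matched match = let (π , π-matches) = Any.satisfied match in matches⇒≅ₚ {π} π-matches
    found : S ≅ₚ T → Any Matches (permutations d)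
    found S≅T = let (σ , σ∈ , σ≈π) = ∈-permutations (perm S≅T)
                in  lose σ∈ (≅ₚ⇒matches (≅ₚ-resp-≈ₚ S≅T {σ} σ≈π))

record Transversal {A : Set} (R : A → A → Set) (xs : List A) : Set where
  field
    size            : ℕ
    representatives : Vec A size
    distinct        : ∀ i j → i ≢ j → ¬ R (lookup representatives i) (lookup representatives j)
    covers          : ∀ {x} → x ∈ xs → ∃ λ i → R x (lookup representatives i)

transversal : {A : Set} {R : A → A → Set} → Reflexive R → Symmetric R → Decidable₂ R →
              (xs : List A) → Transversal R xs
transversal R-refl R-sym R? []ᴸ =
  record { size = 0 ; representatives = [] ; distinct = λ () ; covers = λ () }
transversal {R = R} R-refl R-sym R? (x ∷ᴸ xs) = extend (Fin.any? λ i → R? x (lookup representatives i))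
  where
  T = transversal R-refl R-sym R? xs
  open Transversal T
  extend : Dec (∃ λ i → R x (lookup representatives i)) → Transversal R (x ∷ᴸ xs)
  extend (yes (i , x~rᵢ)) = record
    { size = size ; representatives = representatives ; distinct = distinct
    ; covers = λ { (here refl) → i , x~rᵢ ; (there y∈xs) → covers y∈xs }
    }
  extend (no  x≁reps)     = record
    { size = suc size ; representatives = x ∷ representatives ; distinct = distinct′ ; covers = covers′ }
    where
    distinct′ : ∀ i j → i ≢ j → ¬ R (lookup (x ∷ representatives) i) (lookup (x ∷ representatives) j)
    distinct′ zero    zero    0≢0 _ = 0≢0 refl
    distinct′ zero    (suc j) _   r = x≁reps (j , r)
    distinct′ (suc i) zero    _   r = x≁reps (i , R-sym r)
    distinct′ (suc i) (suc j) i≢j r = distinct i j (i≢j ∘ cong suc) r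
    covers′ : ∀ {y} → y ∈ x ∷ᴸ xs → ∃ λ i → R y (lookup (x ∷ representatives) i)
    covers′ (here refl)  = zero , R-refl
    covers′ (there y∈xs) = let (i , y~rᵢ) = covers y∈xs in suc i , y~rᵢ

IsoClassCount-exists : (g d : ℕ) → ∃ λ n → IsoClassCount g d n
IsoClassCount-exists g d = size , representatives , non-isomorphic , classified
  where
  open Candidates d g
  open Transversal (transversal ≅ₚ-refl ≅ₚ-sym _≅ₚ?_ candidates)
  non-isomorphic : ∀ i j → i ≢ j → ¬ Iso (lookup representatives i) (lookup representatives j)
  non-isomorphic i j i≢j = distinct i j i≢j ∘ Iso⇒≅ₚ
  classified : (S : GNS d g) → ∃ λ i → Iso S (lookup representatives i)
  classified S =
    let (C , C∈ , C≡S) = candidate-with-gaps S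
        (i , C≅rᵢ)     = covers C∈
    in i , ≅ₚ⇒Iso (≅ₚ-trans (gaps≡⇒≅ₚ (sym C≡S)) C≅rᵢ)

-- Adding a coordinate

∈-map-0∷⁻ : {G : List (ℕ^ m)} {a : ℕ} {x : ℕ^ m} → (a ∷ x) ∈ List.map (0 ∷_) G → a ≡ 0 × x ∈ G
∈-map-0∷⁻ a∷x∈ with ∈-map⁻ (0 ∷_) a∷x∈
... | _ , x∈G , refl = refl , x∈G

pad : GNS m g → GNS (suc m) g
pad A = record
  { gaps       = List.map (0 ∷_) (gaps A)
  ; gapsUnique = Unique.map⁺ ∷-injectiveʳ (gapsUnique A)
  ; genus      = trans (length-map _ (gaps A)) (genus A)
  ; zero∈S     = λ 𝟎∈ → zero∈S A (proj₂ (∈-map-0∷⁻ 𝟎∈))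
  ; closed     = closed′
  }
  where
  H = List.map (0 ∷_) (gaps A)
  closed′ : ∀ x y → x ∉ H → y ∉ H → (x ⊕ y) ∉ H
  closed′ (a ∷ x) (b ∷ y) a∷x∉ b∷y∉ sum∈ = closed A x y
    (λ x∈ → a∷x∉ (subst (λ c → (c ∷ x) ∈ H) (sym (m+n≡0⇒m≡0 a a+b≡0)) (∈-map⁺ (0 ∷_) x∈)))
    (λ y∈ → b∷y∉ (subst (λ c → (c ∷ y) ∈ H) (sym (m+n≡0⇒n≡0 a a+b≡0)) (∈-map⁺ (0 ∷_) y∈)))
    x⊕y∈
    where
    a+b≡0 = proj₁ (∈-map-0∷⁻ sum∈)
    x⊕y∈  = proj₂ (∈-map-0∷⁻ sum∈)

pad-gap-head : {A : GNS m g} {y : ℕ^ (suc m)} → y ∈ gaps (pad A) → lookup y zero ≡ 0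
pad-gap-head {y = _ ∷ _} y∈ = proj₁ (∈-map-0∷⁻ y∈)

pad-cong : {A B : GNS m g} → A ≅ₚ B → pad A ≅ₚ pad B
pad-cong {A = A} {B} A≅B = record { perm = lift₀ π ; preserves-gap = preserves ; reflects-gap = reflects }
  where
  π = perm A≅B
  preserves : ∀ {y} → y ∈ gaps (pad A) → permute (lift₀ π) y ∈ gaps (pad B)
  preserves {a ∷ x} y∈ with ∈-map-0∷⁻ y∈
  ... | refl , x∈ = ∈-map⁺ (0 ∷_) (preserves-gap A≅B x∈)
  reflects : ∀ {y} → permute (lift₀ π) y ∈ gaps (pad B) → y ∈ gaps (pad A)
  reflects {a ∷ x} πy∈ with ∈-map-0∷⁻ {a = a} {permute π x} πy∈
  ... | refl , πx∈ = ∈-map⁺ (0 ∷_) (reflects-gap A≅B πx∈)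

fixing⇒≅ₚ : (S : GNS d g) (π : Permutation′ d) → (∀ {x} → x ∈ gaps S → permute π x ≡ x) → S ≅ₚ S
fixing⇒≅ₚ S π fixes = record
  { perm          = π
  ; preserves-gap = λ x∈ → subst (_∈ gaps S) (sym (fixes x∈)) x∈
  ; reflects-gap  = λ πx∈ → subst (_∈ gaps S) (permute-injective π (fixes πx∈)) πx∈
  }

pad-reflect-fixing : {A B : GNS m g} (P : pad A ≅ₚ pad B) → perm P ⟨$⟩ʳ zero ≡ zero → A ≅ₚ B
pad-reflect-fixing {A = A} {B} P π0≡0 = record
  { perm          = ρ
  ; preserves-gap = λ {x} x∈ →
      proj₂ (∈-map-0∷⁻ (subst (_∈ gaps (pad B)) (shape x) (preserves-gap P (∈-map⁺ (0 ∷_) x∈))))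
  ; reflects-gap  = λ {x} ρx∈ →
      proj₂ (∈-map-0∷⁻ (reflects-gap P (subst (_∈ gaps (pad B)) (sym (shape x)) (∈-map⁺ (0 ∷_) ρx∈))))
  }
  where
  π = perm P
  ρ = remove zero π
  shape : ∀ x → permute π (0 ∷ x) ≡ 0 ∷ permute ρ x
  shape x = sym (permute-cong {π = lift₀ ρ} {π} (lift₀-remove π π0≡0) (0 ∷ x))

-- With p = π 0, every gap of pad A vanishes at 0 and at p, so the transposition of 0 and p
-- fixes them; composing with it gives a permutation that fixes 0.
pad-reflect : {A B : GNS m g} → pad A ≅ₚ pad B → A ≅ₚ B
pad-reflect {A = A} {B} P = pad-reflect-fixing (≅ₚ-trans swap0p P) (transpose-matchʳ zero p)
  where
  p = perm P ⟨$⟩ʳ zero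
  vanishes-at-p : ∀ {y} → y ∈ gaps (pad A) → lookup y p ≡ 0
  vanishes-at-p {y} y∈ = trans (sym (lookup-permute (perm P) y zero)) (pad-gap-head {A = B} (preserves-gap P y∈))
  swap0p : pad A ≅ₚ pad A
  swap0p = fixing⇒≅ₚ (pad A) (transpose zero p) λ y∈ →
    permute-transpose _ (trans (pad-gap-head {A = A} y∈) (sym (vanishes-at-p y∈)))

-- The preimage h⁻¹(S) under an additive h with left inverse f; as f also inverts h on the
-- gaps of S, the gaps of h⁻¹(S) are the images under f of those of S.
module Pullback (S : GNS d g) (f : ℕ^ d → ℕ^ e) (h : ℕ^ e → ℕ^ d)
                (h-⊕ : ∀ y z → h (y ⊕ z) ≡ h y ⊕ h z) (h-𝟎 : h 𝟎 ≡ 𝟎)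
                (f∘h : ∀ y → f (h y) ≡ y) (h∘f : ∀ {x} → x ∈ gaps S → h (f x) ≡ x) where

  ∈-pullback⁻ : {y : ℕ^ e} → y ∈ List.map f (gaps S) → h y ∈ gaps S
  ∈-pullback⁻ y∈ with ∈-map⁻ f y∈
  ... | x , x∈ , refl = subst (_∈ gaps S) (sym (h∘f x∈)) x∈

  ∈-pullback⁺ : {y : ℕ^ e} → h y ∈ gaps S → y ∈ List.map f (gaps S)
  ∈-pullback⁺ {y} hy∈ = subst (_∈ List.map f (gaps S)) (f∘h y) (∈-map⁺ f hy∈)

  h-image : List.map h (List.map f (gaps S)) ≡ gaps S
  h-image = trans (sym (map-∘ (gaps S))) (map-id-local (All.tabulate h∘f))

  pullback : GNS e g
  pullback = record
    { gaps       = List.map f (gaps S)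
    ; gapsUnique = Unique.map⁻ (subst Unique (sym h-image) (gapsUnique S))
    ; genus      = trans (length-map f (gaps S)) (genus S)
    ; zero∈S     = λ 𝟎∈ → zero∈S S (subst (_∈ gaps S) h-𝟎 (∈-pullback⁻ 𝟎∈))
    ; closed     = λ y z y∉ z∉ y⊕z∈ → closed S (h y) (h z) (y∉ ∘ ∈-pullback⁺) (z∉ ∘ ∈-pullback⁺)
                                        (subst (_∈ gaps S) (h-⊕ y z) (∈-pullback⁻ y⊕z∈))
    }

module _ (π : Permutation′ d) (S : GNS d g) where
  private
    module P = Pullback S (permute π) (permute (flip π)) (permute-⊕ (flip π)) (permute-𝟎 (flip π))
                        (permute-permute-flip π) (λ {x} _ → permute-flip-permute π x)

  permuteGNS : GNS d g
  permuteGNS = P.pullback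

  ≅ₚ-permuteGNS : S ≅ₚ permuteGNS
  ≅ₚ-permuteGNS = record
    { perm          = π
    ; preserves-gap = ∈-map⁺ (permute π)
    ; reflects-gap  = λ {x} πx∈ → subst (_∈ gaps S) (permute-flip-permute π x) (P.∈-pullback⁻ πx∈)
    }

module _ (S : GNS (suc m) g) (head≡0 : ∀ {x} → x ∈ gaps S → lookup x zero ≡ 0) where
  private
    cons-tail : ∀ {x} → x ∈ gaps S → 0 ∷ tail x ≡ x
    cons-tail {a ∷ x} x∈ = cong (_∷ x) (sym (head≡0 x∈))

    module P = Pullback S tail (0 ∷_) (λ _ _ → refl) refl (λ _ → refl) cons-tail

  unpad : GNS m g
  unpad = P.pullback

  ≅ₚ-pad-unpad : S ≅ₚ pad unpad
  ≅ₚ-pad-unpad = gaps≡⇒≅ₚ (sym P.h-image)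

Lightest : GNS d g → Fin d → ℕ^ d → Set
Lightest S p x = x ∈ gaps S × lookup x p ≢ 0 × (∀ {y} → y ∈ gaps S → lookup y p ≢ 0 → norm x ≤ norm y)

lightest-exists : (S : GNS d g) (p : Fin d) {x : ℕ^ d} → x ∈ gaps S → lookup x p ≢ 0 → ∃ (Lightest S p)
lightest-exists S p x∈ xₚ≢0 = minimal norm (λ y → ¬? (lookup y p ≟ 0)) x∈ xₚ≢0

-- Write x = eₚ + y. If eₚ is a gap, it is a lighter gap than x with nonzero p-coordinate;
-- otherwise y is a gap, lighter than x, whose q-coordinate is still nonzero.
lightest-injective : (S : GNS d g) {p q : Fin d} {x : ℕ^ d} → Lightest S p x → Lightest S q x → p ≡ q
lightest-injective S {p} {q} {x} (x∈ , xₚ≢0 , lightest-p) (_ , x_q≢0 , lightest-q) =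
  decidable-stable (p Fin.≟ q) λ p≢q → refute p≢q (axis p 1 ∈? gaps S)
  where
  y : ℕ^ _
  y = x [ p ]≔ pred (lookup x p)
  split : axis p 1 ⊕ y ≡ x
  split = trans (axis-⊕-update x p 1 _)
    (trans (cong (x [ p ]≔_) (suc-pred _ {{≢-nonZero xₚ≢0}})) ([]≔-lookup x p))
  norm-x : norm x ≡ suc (norm y)
  norm-x = trans (cong norm (sym split)) (trans (norm-⊕ (axis p 1) y) (cong (_+ norm y) (norm-axis p 1)))
  y_q≢0 : p ≢ q → lookup y q ≢ 0
  y_q≢0 p≢q = subst (_≢ 0) (sym (lookup∘update′ (p≢q ∘ sym) x _)) x_q≢0
  refute : p ≢ q → Dec (axis p 1 ∈ gaps S) → ⊥
  refute p≢q (yes eₚ∈) = y_q≢0 p≢q (sum≡0⇒term≡0 (lookup y) (n≤0⇒n≡0 (s≤s⁻¹ norm-x≤1)) q)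
    where
    norm-x≤1 : suc (norm y) ≤ 1
    norm-x≤1 = subst₂ _≤_ norm-x (norm-axis p 1)
      (lightest-p eₚ∈ (subst (_≢ 0) (sym (lookup-axis-≡ p 1)) λ ()))
  refute p≢q (no eₚ∉) = 1+n≰n (subst (_≤ norm y) norm-x (lightest-q y∈ (y_q≢0 p≢q)))
    where
    y∈ : y ∈ gaps S
    y∈ = gap-summand S eₚ∉ (subst (_∈ gaps S) (sym split) x∈)

unused-coordinate : (S : GNS d g) → g < d → ∃ λ p → ∀ {x} → x ∈ gaps S → lookup x p ≡ 0
unused-coordinate {d} S g<d with Fin.any? (λ p → All.all? (λ x → lookup x p ≟ 0) (gaps S))
... | yes (p , vanishes) = p , All.lookup vanishes
... | no  all-used = contradiction (gaps-injective⇒≤genus S witness witness-injective witness∈H) (<⇒≱ g<d)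
  where
  lightest : ∀ p → ∃ (Lightest S p)
  lightest p =
    let (x , x∈ , xₚ≢0) = find (¬All⇒Any¬ (λ x → lookup x p ≟ 0) (gaps S) λ vanish → all-used (p , vanish))
    in  lightest-exists S p x∈ xₚ≢0
  witness : Fin d → ℕ^ d
  witness p = proj₁ (lightest p)
  witness-injective : Injective _≡_ _≡_ witness
  witness-injective {p} {q} eq =
    lightest-injective S (proj₂ (lightest p)) (subst (Lightest S q) (sym eq) (proj₂ (lightest q)))
  witness∈H : ∀ p → witness p ∈ gaps S
  witness∈H p = proj₁ (proj₂ (lightest p))

≅ₚ-pad : (S : GNS (suc m) g) → g < suc m → ∃ λ A → S ≅ₚ pad A
≅ₚ-pad S g<1+m = unpad S′ head≡0 , ≅ₚ-trans (≅ₚ-permuteGNS τ S) (≅ₚ-pad-unpad S′ head≡0)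
  where
  p = proj₁ (unused-coordinate S g<1+m)
  p-unused = proj₂ (unused-coordinate S g<1+m)
  τ = transpose zero p
  S′ = permuteGNS τ S
  head≡0 : ∀ {x} → x ∈ gaps S′ → lookup x zero ≡ 0
  head≡0 {x} x∈ = begin
    lookup x zero                                 ≡⟨ cong (λ y → lookup y zero) (permute-permute-flip τ x) ⟨
    lookup (permute τ (permute (flip τ) x)) zero  ≡⟨ lookup-permute τ (permute (flip τ) x) zero ⟩
    lookup (permute (flip τ) x) (τ ⟨$⟩ʳ zero)     ≡⟨ cong (lookup (permute (flip τ) x)) (transpose-matchˡ zero p) ⟩
    lookup (permute (flip τ) x) p                 ≡⟨ p-unused (preserves-gap (≅ₚ-sym (≅ₚ-permuteGNS τ S)) x∈) ⟩
    0                                             ∎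
    where open ≡-Reasoning

IsoClassCount-suc : g ≤ m → IsoClassCount g m n → IsoClassCount g (suc m) n
IsoClassCount-suc {g} {m} {n} g≤m (reps , non-isomorphic , classified) =
  map pad reps , non-isomorphic′ , classified′
  where
  lookup-pad : ∀ i → lookup (map pad reps) i ≡ pad (lookup reps i)
  lookup-pad i = lookup-map i pad reps
  non-isomorphic′ : ∀ i j → i ≢ j → ¬ Iso (lookup (map pad reps) i) (lookup (map pad reps) j)
  non-isomorphic′ i j i≢j iso = non-isomorphic i j i≢j
    (≅ₚ⇒Iso (pad-reflect (Iso⇒≅ₚ (subst₂ Iso (lookup-pad i) (lookup-pad j) iso))))
  classified′ : (S : GNS (suc m) g) → ∃ λ i → Iso S (lookup (map pad reps) i)
  classified′ S =
    let (A , S≅A′) = ≅ₚ-pad S (s≤s g≤m)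
        (i , A≅rᵢ) = classified A
    in i , subst (Iso S) (sym (lookup-pad i)) (≅ₚ⇒Iso (≅ₚ-trans S≅A′ (pad-cong (Iso⇒≅ₚ A≅rᵢ))))

IsoClassCount-stable : g ≤′ d → IsoClassCount g g n → IsoClassCount g d n
IsoClassCount-stable ≤′-refl         count = count
IsoClassCount-stable (≤′-step g≤′d) count =
  IsoClassCount-suc (≤′⇒≤ g≤′d) (IsoClassCount-stable g≤′d count)

mainTheorem2 : (g : ℕ) → 1 ≤ g → (d : ℕ) → g ≤ d →
    ∃ λ (n : ℕ) → IsoClassCount g d n × IsoClassCount g g n
mainTheorem2 g _ d g≤d =
  let (n , count) = IsoClassCount-exists g g
  in n , IsoClassCount-stable (≤⇒≤′ g≤d) count , count
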